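{- Let $f:\{0,1\}^n\to\mathbb{R}$ be $f(x)=n-2|x|$, whose values are $\xi_j=2j-n$, $0\le j\le n$. Let $p\in[0,1]$ and let $M_p(x)$ denote bit-flip mutation with probability $p$ applied to $x$. Then for every $x$ with $f(x)=\xi_i$, $$\Pr[f(M_p(x))=\xi_j]=\varpi_{i,j}:=\frac{1}{2^n}\sum_{l=0}^nK^{(n)}_{j,l}(1-2p)^lK^{(n)}_{l,i},\qquad 0\le i,j\le n.$$
   Context: $|x|$ is the number of ones of $x$. Bit-flip mutation: each bit flipped independently with probability $p$. Krawtchouk entries: $K^{(n)}_{r,j}=\sum_{l=0}^n(-1)^l\binom{n-j}{r-l}\binom{j}{l}$, with $\binom{a}{b}=0$ if $b>a$ or $b<0$.
   Formalization: The mutation probability p ranges over the rationals in [0,1] rather than over the real interval. -}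

module Defs where

open import Data.Bool using (Bool; true; false; if_then_else_)
open import Data.Nat as ℕ using (ℕ; zero; suc; _∸_; _≤ᵇ_)
open import Data.Nat.Combinatorics using (_C_)
open import Data.Fin using (Fin; toℕ)
open import Data.Vec using (Vec; []; _∷_)
open import Data.List using (List; []; _∷_; map; _++_; foldr; upTo)
open import Data.Integer as ℤ using (ℤ; +_)
open import Data.Rational as ℚ using (ℚ; 0ℚ; 1ℚ)
open import Relation.Nullary.Decidable using (⌊_⌋)
open import Data.Nat.Properties using (m^n≢0)

Bits : ℕ → Set
Bits n = Vec Bool n

allBits : (n : ℕ) → List (Bits n)
allBits zero = [] ∷ []
allBits (suc n) = map (false ∷_) (allBits n) ++ map (true ∷_) (allBits n)

ones : ∀ {n} → Bits n → ℕ
ones [] = 0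
ones (true ∷ x) = suc (ones x)
ones (false ∷ x) = ones x

f : ∀ {n} → Bits n → ℤ
f {n} x = + n ℤ.- (+ 2) ℤ.* (+ ones x)

ξ : (n j : ℕ) → ℤ
ξ n j = (+ 2) ℤ.* (+ j) ℤ.- + n

_^ℚ_ : ℚ → ℕ → ℚ
q ^ℚ zero = 1ℚ
q ^ℚ suc k = q ℚ.* (q ^ℚ k)

sumℚ : List ℚ → ℚ
sumℚ = foldr ℚ._+_ 0ℚ

sumℤ : List ℤ → ℤ
sumℤ = foldr ℤ._+_ (+ 0)

mutProb : ∀ {n} → ℚ → Bits n → Bits n → ℚ
mutProb p [] [] = 1ℚ
mutProb p (a ∷ x) (b ∷ y) =
  (if a Data.Bool.xor b then p else (1ℚ ℚ.- p)) ℚ.* mutProb p x y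
  where import Data.Bool

PrMut : ∀ {n} → ℚ → Bits n → ℤ → ℚ
PrMut {n} p x v =
  sumℚ (map (λ y → if ⌊ f y ℤ.≟ v ⌋ then mutProb p x y else 0ℚ) (allBits n))

-- binomial coefficient binom(a, r - l) for integers r - l, 0 when r - l < 0
-- (_C_ is already 0 when the lower index exceeds the upper one)
binomDiff : ℕ → ℕ → ℕ → ℕ
binomDiff a r l = if l ≤ᵇ r then a C (r ∸ l) else 0

sgn : ℕ → ℤ
sgn zero = + 1
sgn (suc l) = ℤ.- sgn l

K : (n r j : ℕ) → ℤ
K n r j = sumℤ (map (λ l → sgn l ℤ.* (+ binomDiff (n ∸ j) r l) ℤ.* (+ (j C l))) (upTo (suc n)))

ϖ : (n : ℕ) → ℚ → ℕ → ℕ → ℚ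
ϖ n p i j =
  ((+ 1) ℚ./ (2 ℕ.^ n)) {{m^n≢0 2 n}} ℚ.*
    sumℚ (map (λ l → ((K n j l ℚ./ 1) ℚ.* ((1ℚ ℚ.- (+ 2 ℚ./ 1) ℚ.* p) ^ℚ l)) ℚ.* (K n l i ℚ./ 1))
              (upTo (suc n)))

{-# OPTIONS --safe #-}
module Submission where

-- Bit-flip mutation is diagonalised by the Walsh characters χ z x = (-1)^|z ∧ x|: it acts
-- independently on each bit, and on one bit 1 + (1 - 2p)(-1)^c is twice the probability that
-- the bit changes by c, so
--   2^n · Pr[M_p(x) = y] = Σ_z (1 - 2p)^|z| χ z x χ z y.
-- Since f y = ξ_j exactly when the complement of y has j ones, and mutation commutes with
-- complementing, the probability in question is the mass that M_p(x̄) puts on the Hamming level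
-- |y| = j. Summing a character over the level |u| = r gives a Krawtchouk number,
--   Σ_{|u| = r} χ u w = K_r(|w|),
-- by induction on the length, the two Pascal-type recurrences of K matching w's first bit.
-- Grouping the z-sum by the level l = |z| then yields 2^{-n} Σ_l K_j(l) (1 - 2p)^l K_l(|x̄|),
-- and |x̄| = i.

open import Defs
open import Algebra.Bundles using (CommutativeRing)
open import Data.Bool using (Bool; true; false; not; _∧_; _xor_; if_then_else_)
open import Data.Bool.Properties using (∧-comm)
open import Data.List using (List; []; _∷_; map; _++_; foldr; upTo)
import Data.List.Properties as List
open import Data.Nat as ℕ using (ℕ; zero; suc; _∸_; _≡ᵇ_; _≤_; _<_; z≤n; s≤s; _≤′_; ≤′-refl; ≤′-step)
import Data.Nat.Properties as ℕ
open import Data.Nat.Combinatorics using (_C_; nCk+nC[k+1]≡[n+1]C[k+1]; k>n⇒nCk≡0)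
open import Data.Vec as Vec using ([]; _∷_)
open import Function using (_∘_; _⇔_; mk⇔; Equivalence)
open import Function.Properties.Equivalence using () renaming (trans to ⇔-trans)
open import Relation.Nullary.Decidable using (⌊_⌋; dec⇒maybe; isYes≗does; does-⇔)
import Relation.Binary.PropositionalEquality as ≡

complement : ∀ {n} → Bits n → Bits n
complement = Vec.map not

ones≤length : ∀ {n} (x : Bits n) → ones x ≤ n
ones≤length []          = z≤n
ones≤length (true ∷ x)  = s≤s (ones≤length x)
ones≤length (false ∷ x) = ℕ.m≤n⇒m≤1+n (ones≤length x)

module ListSum {a ℓ} (R : CommutativeRing a ℓ) where

  open CommutativeRing R
  open import Algebra.Properties.Ring ring using (-0#≈0#; -‿+-comm)
  open import Algebra.Properties.CommutativeSemigroup +-commutativeSemigroup using (interchange)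
  open import Relation.Binary.Reasoning.Setoid setoid

  private variable
    A B : Set

  ∑ : List A → (A → Carrier) → Carrier
  ∑ xs g = foldr _+_ 0# (map g xs)

  syntax ∑ xs (λ x → e) = ∑[ x ∈ xs ] e

  ∑-cong : (xs : List A) {g h : A → Carrier} → (∀ x → g x ≈ h x) → ∑ xs g ≈ ∑ xs h
  ∑-cong []       g≈h = refl
  ∑-cong (x ∷ xs) g≈h = +-cong (g≈h x) (∑-cong xs g≈h)

  ∑-zero : (xs : List A) {g : A → Carrier} → (∀ x → g x ≈ 0#) → ∑ xs g ≈ 0#
  ∑-zero []       g≈0 = refl
  ∑-zero (x ∷ xs) g≈0 = trans (+-cong (g≈0 x) (∑-zero xs g≈0)) (+-identityˡ 0#)

  ∑-++ : (xs ys : List A) (g : A → Carrier) → ∑ (xs ++ ys) g ≈ ∑ xs g + ∑ ys g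
  ∑-++ []       ys g = sym (+-identityˡ _)
  ∑-++ (x ∷ xs) ys g = trans (+-congˡ (∑-++ xs ys g)) (sym (+-assoc _ _ _))

  ∑-map : (xs : List B) (h : B → A) (g : A → Carrier) → ∑ (map h xs) g ≡.≡ ∑ xs (g ∘ h)
  ∑-map xs h g = ≡.cong (foldr _+_ 0#) (≡.sym (List.map-∘ xs))

  ∑-+ : (xs : List A) (g h : A → Carrier) → ∑[ x ∈ xs ] (g x + h x) ≈ ∑ xs g + ∑ xs h
  ∑-+ []       g h = sym (+-identityˡ 0#)
  ∑-+ (x ∷ xs) g h = trans (+-congˡ (∑-+ xs g h)) (interchange _ _ _ _)

  ∑-neg : (xs : List A) (g : A → Carrier) → ∑[ x ∈ xs ] (- g x) ≈ - ∑ xs g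
  ∑-neg []       g = sym -0#≈0#
  ∑-neg (x ∷ xs) g = trans (+-congˡ (∑-neg xs g)) (-‿+-comm _ _)

  ∑-*ˡ : (xs : List A) (c : Carrier) (g : A → Carrier) → ∑[ x ∈ xs ] (c * g x) ≈ c * ∑ xs g
  ∑-*ˡ []       c g = sym (zeroʳ c)
  ∑-*ˡ (x ∷ xs) c g = trans (+-congˡ (∑-*ˡ xs c g)) (sym (distribˡ c _ _))

  ∑-swap : (xs : List A) (ys : List B) (g : A → B → Carrier) →
           ∑[ x ∈ xs ] ∑[ y ∈ ys ] g x y ≈ ∑[ y ∈ ys ] ∑[ x ∈ xs ] g x y
  ∑-swap []       ys g = sym (∑-zero ys (λ _ → refl))
  ∑-swap (x ∷ xs) ys g = trans (+-congˡ (∑-swap xs ys g)) (sym (∑-+ ys (g x) _))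

  ∑-upTo-suc : ∀ n (g : ℕ → Carrier) → ∑ (upTo (suc n)) g ≡.≡ g 0 + ∑ (upTo n) (g ∘ suc)
  ∑-upTo-suc n g = ≡.cong (g 0 +_) (≡.trans (≡.cong (λ xs → ∑ xs g) (≡.sym (List.map-upTo suc n)))
                                            (∑-map (upTo n) suc g))

  ∑-upTo-last : ∀ n (g : ℕ → Carrier) → ∑ (upTo (suc n)) g ≈ ∑ (upTo n) g + g n
  ∑-upTo-last n g = begin
    ∑ (upTo (suc n)) g          ≡⟨ ≡.cong (λ xs → ∑ xs g) (List.upTo-∷ʳ n) ⟨
    ∑ (upTo n ++ n ∷ []) g      ≈⟨ ∑-++ (upTo n) (n ∷ []) g ⟩
    ∑ (upTo n) g + (g n + 0#)   ≈⟨ +-congˡ (+-identityʳ (g n)) ⟩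
    ∑ (upTo n) g + g n          ∎

  ∑-upTo-vanishing : ∀ {m n} (g : ℕ → Carrier) → (∀ l → m ≤ l → g l ≈ 0#) → m ≤ n →
                     ∑ (upTo n) g ≈ ∑ (upTo m) g
  ∑-upTo-vanishing {m} g g≈0 m≤n = go (ℕ.≤⇒≤′ m≤n)
    where
    go : ∀ {n} → m ≤′ n → ∑ (upTo n) g ≈ ∑ (upTo m) g
    go ≤′-refl            = refl
    go (≤′-step {n} m≤′n) = begin
      ∑ (upTo (suc n)) g   ≈⟨ ∑-upTo-last n g ⟩
      ∑ (upTo n) g + g n   ≈⟨ +-congˡ (g≈0 n (ℕ.≤′⇒≤ m≤′n)) ⟩
      ∑ (upTo n) g + 0#    ≈⟨ +-identityʳ _ ⟩
      ∑ (upTo n) g         ≈⟨ go m≤′n ⟩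
      ∑ (upTo m) g         ∎

  ∑-upTo-indicator : ∀ {m n} (x : Carrier) → m ≤ n → ∑[ l ∈ upTo (suc n) ] (if m ≡ᵇ l then x else 0#) ≈ x
  ∑-upTo-indicator {zero} {n} x _ = begin
    ∑[ l ∈ upTo (suc n) ] (if 0 ≡ᵇ l then x else 0#)            ≡⟨ ∑-upTo-suc n _ ⟩
    x + ∑[ l ∈ upTo n ] 0#                                      ≈⟨ +-congˡ (∑-zero (upTo n) (λ _ → refl)) ⟩
    x + 0#                                                      ≈⟨ +-identityʳ x ⟩
    x                                                           ∎
  ∑-upTo-indicator {suc m} {suc n} x (s≤s m≤n) = begin
    ∑[ l ∈ upTo (suc (suc n)) ] (if suc m ≡ᵇ l then x else 0#)  ≡⟨ ∑-upTo-suc (suc n) _ ⟩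
    0# + ∑[ l ∈ upTo (suc n) ] (if m ≡ᵇ l then x else 0#)       ≈⟨ +-identityˡ _ ⟩
    ∑[ l ∈ upTo (suc n) ] (if m ≡ᵇ l then x else 0#)            ≈⟨ ∑-upTo-indicator x m≤n ⟩
    x                                                           ∎

module CubeSum {a ℓ} (R : CommutativeRing a ℓ) where

  open CommutativeRing R
  open ListSum R public
  open import Relation.Binary.Reasoning.Setoid setoid

  ∑-allBits-suc : ∀ n (g : Bits (suc n) → Carrier) →
                  ∑ (allBits (suc n)) g ≈ ∑[ y ∈ allBits n ] g (false ∷ y) + ∑[ y ∈ allBits n ] g (true ∷ y)
  ∑-allBits-suc n g = trans (∑-++ (map (false ∷_) (allBits n)) _ g)
                            (+-cong (reflexive (∑-map (allBits n) _ g)) (reflexive (∑-map (allBits n) _ g)))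

  ∑-allBits-complement : ∀ n (g : Bits n → Carrier) → ∑[ y ∈ allBits n ] g (complement y) ≈ ∑ (allBits n) g
  ∑-allBits-complement zero    g = refl
  ∑-allBits-complement (suc n) g = begin
    ∑[ y ∈ allBits (suc n) ] g (complement y)
      ≈⟨ ∑-allBits-suc n (g ∘ complement) ⟩
    ∑[ y ∈ allBits n ] g (true ∷ complement y) + ∑[ y ∈ allBits n ] g (false ∷ complement y)
      ≈⟨ +-cong (∑-allBits-complement n (g ∘ (true ∷_))) (∑-allBits-complement n (g ∘ (false ∷_))) ⟩
    ∑[ y ∈ allBits n ] g (true ∷ y) + ∑[ y ∈ allBits n ] g (false ∷ y)
      ≈⟨ +-comm _ _ ⟩
    ∑[ y ∈ allBits n ] g (false ∷ y) + ∑[ y ∈ allBits n ] g (true ∷ y)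
      ≈⟨ ∑-allBits-suc n g ⟨
    ∑ (allBits (suc n)) g ∎

  levelSum : ∀ n → ℕ → (Bits n → Carrier) → Carrier
  levelSum n r g = ∑[ y ∈ allBits n ] (if ones y ≡ᵇ r then g y else 0#)

  ∑-by-levels : ∀ n (g : Bits n → Carrier) → ∑ (allBits n) g ≈ ∑[ l ∈ upTo (suc n) ] levelSum n l g
  ∑-by-levels n g = trans (∑-cong (allBits n) (λ y → sym (∑-upTo-indicator (g y) (ones≤length y))))
                          (∑-swap (allBits n) (upTo (suc n)) _)

  levelSum-cong : ∀ n r {g h : Bits n → Carrier} → (∀ y → g y ≈ h y) → levelSum n r g ≈ levelSum n r h
  levelSum-cong n r g≈h = ∑-cong (allBits n) (λ y → if-cong (ones y ≡ᵇ r) (g≈h y))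
    where
    if-cong : ∀ b {x y} → x ≈ y → (if b then x else 0#) ≈ (if b then y else 0#)
    if-cong true  x≈y = x≈y
    if-cong false _   = refl

  *-levelSum : ∀ n r (c : Carrier) (g : Bits n → Carrier) → c * levelSum n r g ≈ levelSum n r (λ y → c * g y)
  *-levelSum n r c g = trans (sym (∑-*ˡ (allBits n) c _)) (∑-cong (allBits n) (λ y → *-if (ones y ≡ᵇ r)))
    where
    *-if : ∀ b {x} → c * (if b then x else 0#) ≈ (if b then c * x else 0#)
    *-if true  = refl
    *-if false = zeroʳ c

  levelSum-∑ : ∀ {A : Set} n r (zs : List A) (h : A → Bits n → Carrier) →
               levelSum n r (λ y → ∑[ z ∈ zs ] h z y) ≈ ∑[ z ∈ zs ] levelSum n r (h z)
  levelSum-∑ {A} n r zs h = trans (∑-cong (allBits n) (λ y → if-∑ (ones y ≡ᵇ r))) (∑-swap (allBits n) zs _)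
    where
    if-∑ : ∀ b {g : A → Carrier} → (if b then ∑ zs g else 0#) ≈ ∑[ z ∈ zs ] (if b then g z else 0#)
    if-∑ true  = refl
    if-∑ false = sym (∑-zero zs (λ _ → refl))

  levelSum-ones : ∀ n r (F : ℕ → Carrier) (g : Bits n → Carrier) →
                  levelSum n r (λ y → F (ones y) * g y) ≈ F r * levelSum n r g
  levelSum-ones n r F g = trans (∑-cong (allBits n) (λ y → if-ones (ones y))) (∑-*ˡ (allBits n) (F r) _)
    where
    if-ones : ∀ m {x} → (if m ≡ᵇ r then F m * x else 0#) ≈ F r * (if m ≡ᵇ r then x else 0#)
    if-ones m with m ≡ᵇ r | ℕ.≡ᵇ⇒≡ m r
    ... | true  | m≡r = reflexive (≡.cong (λ k → F k * _) (m≡r _))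
    ... | false | _   = sym (zeroʳ (F r))

  levelSum-suc : ∀ n r (g : Bits (suc n) → Carrier) →
                 levelSum (suc n) (suc r) g ≈ levelSum n (suc r) (g ∘ (false ∷_)) + levelSum n r (g ∘ (true ∷_))
  levelSum-suc n r g = ∑-allBits-suc n _

  levelSum-zero : ∀ n (g : Bits (suc n) → Carrier) → levelSum (suc n) 0 g ≈ levelSum n 0 (g ∘ (false ∷_))
  levelSum-zero n g = trans (∑-allBits-suc n _) (trans (+-congˡ (∑-zero (allBits n) (λ _ → refl))) (+-identityʳ _))

open ≡ using (_≡_; refl; cong; cong₂; sym; trans)

binomDiff-suc : ∀ d r l → binomDiff d (suc r) (suc l) ≡ binomDiff d r l
binomDiff-suc d r zero    = refl
binomDiff-suc d r (suc l) = refl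

binomDiff-pascal : ∀ d r l → binomDiff (suc d) (suc r) l ≡ binomDiff d (suc r) l ℕ.+ binomDiff d r l
binomDiff-pascal d r       zero          = trans (sym (nCk+nC[k+1]≡[n+1]C[k+1] d r)) (ℕ.+-comm (d C r) _)
binomDiff-pascal d zero    (suc zero)    = refl
binomDiff-pascal d zero    (suc (suc l)) = refl
binomDiff-pascal d (suc r) (suc l)       = begin
  binomDiff (suc d) (suc (suc r)) (suc l)                              ≡⟨ binomDiff-suc (suc d) (suc r) l ⟩
  binomDiff (suc d) (suc r) l                                          ≡⟨ binomDiff-pascal d r l ⟩
  binomDiff d (suc r) l ℕ.+ binomDiff d r l                            ≡⟨ cong₂ ℕ._+_ (binomDiff-suc d (suc r) l)
                                                                                      (binomDiff-suc d r l) ⟨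
  binomDiff d (suc (suc r)) (suc l) ℕ.+ binomDiff d (suc r) (suc l)    ∎
  where open ≡.≡-Reasoning

module Krawtchouk where

  open import Data.Integer as ℤ using (ℤ; +_; _+_; _*_; -_; _-_)
  import Data.Integer.Properties as ℤ
  open import Data.Integer.Tactic.RingSolver using (solve-∀)
  open ListSum ℤ.+-*-commutativeRing using (∑; ∑-cong; ∑-zero; ∑-+; ∑-neg; ∑-upTo-suc; ∑-upTo-vanishing)
  open ≡.≡-Reasoning

  krawTerm : (d r j l : ℕ) → ℤ
  krawTerm d r j l = sgn l * + binomDiff d r l * + (j C l)

  -- kraw d r j is K^{(d+j)}_{r,j} summed only up to l = j, beyond which binom(j,l) vanishes;
  -- in this form the Pascal recurrences need no side conditions.
  kraw : (d r j : ℕ) → ℤ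
  kraw d r j = ∑[ l ∈ upTo (suc j) ] krawTerm d r j l

  krawTerm-vanishes : ∀ d r {j l} → j < l → krawTerm d r j l ≡ + 0
  krawTerm-vanishes d r {j} {l} j<l = trans (cong (λ c → sgn l * + binomDiff d r l * + c) (k>n⇒nCk≡0 j<l))
                                            (ℤ.*-zeroʳ (sgn l * + binomDiff d r l))

  K≡kraw : ∀ {n j} r → j ≤ n → K n r j ≡ kraw (n ∸ j) r j
  K≡kraw {n} {j} r j≤n =
    ∑-upTo-vanishing (krawTerm (n ∸ j) r j) (λ l → krawTerm-vanishes (n ∸ j) r) (s≤s j≤n)

  kraw-row-zero : ∀ d j → kraw d 0 j ≡ + 1
  kraw-row-zero d j = begin
    kraw d 0 j                                     ≡⟨ ∑-upTo-suc j (krawTerm d 0 j) ⟩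
    + 1 + ∑[ l ∈ upTo j ] krawTerm d 0 j (suc l)   ≡⟨ cong (λ s → + 1 + s) (∑-zero (upTo j) vanishes) ⟩
    + 1                                            ∎
    where
    vanishes : ∀ l → krawTerm d 0 j (suc l) ≡ + 0
    vanishes l = trans (cong (_* + (j C suc l)) (ℤ.*-zeroʳ (sgn (suc l)))) (ℤ.*-zeroˡ (+ (j C suc l)))

  kraw-pascal⁺ : ∀ d r j → kraw (suc d) (suc r) j ≡ kraw d (suc r) j + kraw d r j
  kraw-pascal⁺ d r j =
    trans (∑-cong (upTo (suc j)) term-pascal) (∑-+ (upTo (suc j)) (krawTerm d (suc r) j) (krawTerm d r j))
    where
    term-pascal : ∀ l → krawTerm (suc d) (suc r) j l ≡ krawTerm d (suc r) j l + krawTerm d r j l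
    term-pascal l = begin
      sgn l * + binomDiff (suc d) (suc r) l * + (j C l)
        ≡⟨ cong (λ b → sgn l * b * + (j C l))
                (trans (cong +_ (binomDiff-pascal d r l)) (ℤ.pos-+ (binomDiff d (suc r) l) (binomDiff d r l))) ⟩
      sgn l * (+ binomDiff d (suc r) l + + binomDiff d r l) * + (j C l)
        ≡⟨ cong (_* + (j C l)) (ℤ.*-distribˡ-+ (sgn l) _ _) ⟩
      (sgn l * + binomDiff d (suc r) l + sgn l * + binomDiff d r l) * + (j C l)
        ≡⟨ ℤ.*-distribʳ-+ (+ (j C l)) (sgn l * + binomDiff d (suc r) l) (sgn l * + binomDiff d r l) ⟩
      krawTerm d (suc r) j l + krawTerm d r j l ∎

  kraw-pascal⁻ : ∀ d r j → kraw d (suc r) (suc j) ≡ kraw d (suc r) j - kraw d r j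
  kraw-pascal⁻ d r j = begin
    kraw d (suc r) (suc j)
      ≡⟨ ∑-upTo-suc (suc j) (krawTerm d (suc r) (suc j)) ⟩
    T 0 + ∑[ l ∈ upTo (suc j) ] krawTerm d (suc r) (suc j) (suc l)
      ≡⟨ cong (_+_ (T 0)) (∑-cong (upTo (suc j)) term-pascal) ⟩
    T 0 + ∑[ l ∈ upTo (suc j) ] (T (suc l) + - krawTerm d r j l)
      ≡⟨ cong (_+_ (T 0)) (trans (∑-+ (upTo (suc j)) (T ∘ suc) (λ l → - krawTerm d r j l))
                                 (cong (_+_ (∑[ l ∈ upTo (suc j) ] T (suc l))) (∑-neg (upTo (suc j)) (krawTerm d r j)))) ⟩
    T 0 + (∑[ l ∈ upTo (suc j) ] T (suc l) - kraw d r j)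
      ≡⟨ ℤ.+-assoc (T 0) _ _ ⟨
    (T 0 + ∑[ l ∈ upTo (suc j) ] T (suc l)) - kraw d r j
      ≡⟨ cong (_- kraw d r j) (sym (∑-upTo-suc (suc j) T)) ⟩
    ∑[ l ∈ upTo (suc (suc j)) ] T l - kraw d r j
      ≡⟨ cong (_- kraw d r j) (∑-upTo-vanishing T (λ l → krawTerm-vanishes d (suc r)) (ℕ.n≤1+n (suc j))) ⟩
    kraw d (suc r) j - kraw d r j ∎
    where
    T : ℕ → ℤ
    T = krawTerm d (suc r) j
    distrib : ∀ s b x y → - s * b * (x + y) ≡ - s * b * y + - (s * b * x)
    distrib = solve-∀
    term-pascal : ∀ l → krawTerm d (suc r) (suc j) (suc l) ≡ T (suc l) + - krawTerm d r j l
    term-pascal l = begin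
      - sgn l * + binomDiff d (suc r) (suc l) * + (suc j C suc l)
        ≡⟨ cong₂ (λ b c → - sgn l * + b * c) (binomDiff-suc d r l)
                 (trans (cong +_ (sym (nCk+nC[k+1]≡[n+1]C[k+1] j l))) (ℤ.pos-+ (j C l) (j C suc l))) ⟩
      - sgn l * + binomDiff d r l * (+ (j C l) + + (j C suc l))
        ≡⟨ distrib (sgn l) (+ binomDiff d r l) (+ (j C l)) (+ (j C suc l)) ⟩
      - sgn l * + binomDiff d r l * + (j C suc l) + - krawTerm d r j l
        ≡⟨ cong (λ b → - sgn l * + b * + (j C suc l) + - krawTerm d r j l) (binomDiff-suc d r l) ⟨
      T (suc l) + - krawTerm d r j l ∎

open Krawtchouk using (kraw; K≡kraw; kraw-row-zero; kraw-pascal⁺; kraw-pascal⁻)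

open import Data.Integer as ℤ using (ℤ; +_)
import Data.Integer.Properties as ℤ
import Data.Integer.Tactic.RingSolver as ℤ-Solver
open import Data.Rational as ℚ using (ℚ; 0ℚ; 1ℚ; _+_; _*_; -_; _-_; _/_) renaming (_≤_ to _≤ℚ_)
import Data.Rational.Properties as ℚ
import Data.Rational.Unnormalised as ℚᵘ
import Data.Rational.Unnormalised.Properties as ℚᵘ
open import Algebra.Properties.Ring ℚ.+-*-ring using (-1*x≈-x)
open import Tactic.RingSolver using (solve-∀)
open import Tactic.RingSolver.Core.AlmostCommutativeRing using (AlmostCommutativeRing; fromCommutativeRing)

fromℤ : ℤ → ℚ
fromℤ i = i / 1

toℚᵘ-fromℤ : ∀ i → ℚ.toℚᵘ (fromℤ i) ℚᵘ.≃ ℚᵘ.mkℚᵘ i 0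
toℚᵘ-fromℤ i = ℚ.toℚᵘ-fromℚᵘ (ℚᵘ.mkℚᵘ i 0)

fromℤ-homo-+ : ∀ i j → fromℤ (i ℤ.+ j) ≡ fromℤ i + fromℤ j
fromℤ-homo-+ i j = ℚ.toℚᵘ-injective (begin
  ℚ.toℚᵘ (fromℤ (i ℤ.+ j))                ≈⟨ toℚᵘ-fromℤ (i ℤ.+ j) ⟩
  ℚᵘ.mkℚᵘ (i ℤ.+ j) 0                     ≈⟨ ℚᵘ.*≡* (cross-multiplied i j) ⟩
  ℚᵘ.mkℚᵘ i 0 ℚᵘ.+ ℚᵘ.mkℚᵘ j 0            ≈⟨ ℚᵘ.+-cong (toℚᵘ-fromℤ i) (toℚᵘ-fromℤ j) ⟨
  ℚ.toℚᵘ (fromℤ i) ℚᵘ.+ ℚ.toℚᵘ (fromℤ j)  ≈⟨ ℚ.toℚᵘ-homo-+ (fromℤ i) (fromℤ j) ⟨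
  ℚ.toℚᵘ (fromℤ i + fromℤ j)              ∎)
  where
  open ℚᵘ.≃-Reasoning
  cross-multiplied : ∀ i j → (i ℤ.+ j) ℤ.* + 1 ≡ (i ℤ.* + 1 ℤ.+ j ℤ.* + 1) ℤ.* + 1
  cross-multiplied = ℤ-Solver.solve-∀

fromℤ-homo-* : ∀ i j → fromℤ (i ℤ.* j) ≡ fromℤ i * fromℤ j
fromℤ-homo-* i j = ℚ.toℚᵘ-injective (begin
  ℚ.toℚᵘ (fromℤ (i ℤ.* j))                ≈⟨ toℚᵘ-fromℤ (i ℤ.* j) ⟩
  ℚᵘ.mkℚᵘ (i ℤ.* j) 0                     ≈⟨ ℚᵘ.*-cong (toℚᵘ-fromℤ i) (toℚᵘ-fromℤ j) ⟨
  ℚ.toℚᵘ (fromℤ i) ℚᵘ.* ℚ.toℚᵘ (fromℤ j)  ≈⟨ ℚ.toℚᵘ-homo-* (fromℤ i) (fromℤ j) ⟨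
  ℚ.toℚᵘ (fromℤ i * fromℤ j)              ∎)
  where open ℚᵘ.≃-Reasoning

fromℤ-homo‿- : ∀ i → fromℤ (ℤ.- i) ≡ - fromℤ i
fromℤ-homo‿- i = ℚ.toℚᵘ-injective (begin
  ℚ.toℚᵘ (fromℤ (ℤ.- i))  ≈⟨ toℚᵘ-fromℤ (ℤ.- i) ⟩
  ℚᵘ.- ℚᵘ.mkℚᵘ i 0        ≈⟨ ℚᵘ.-‿cong (toℚᵘ-fromℤ i) ⟨
  ℚᵘ.- ℚ.toℚᵘ (fromℤ i)   ≈⟨ ℚ.toℚᵘ-homo‿- (fromℤ i) ⟨
  ℚ.toℚᵘ (- fromℤ i)      ∎)
  where open ℚᵘ.≃-Reasoning

1/-*-fromℤ : ∀ m .{{_ : ℕ.NonZero m}} → (+ 1 / m) * fromℤ (+ m) ≡ 1ℚ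
1/-*-fromℤ m@(suc k) = ℚ.toℚᵘ-injective (begin
  ℚ.toℚᵘ ((+ 1 / m) * fromℤ (+ m))            ≈⟨ ℚ.toℚᵘ-homo-* (+ 1 / m) (fromℤ (+ m)) ⟩
  ℚ.toℚᵘ (+ 1 / m) ℚᵘ.* ℚ.toℚᵘ (fromℤ (+ m))  ≈⟨ ℚᵘ.*-cong (ℚ.toℚᵘ-fromℚᵘ (ℚᵘ.mkℚᵘ (+ 1) k))
                                                              (toℚᵘ-fromℤ (+ m)) ⟩
  ℚᵘ.mkℚᵘ (+ 1) k ℚᵘ.* ℚᵘ.mkℚᵘ (+ m) 0        ≈⟨ ℚᵘ.*≡* (cross-multiplied (+ m)) ⟩
  ℚ.toℚᵘ 1ℚ                                   ∎)
  where
  open ℚᵘ.≃-Reasoning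
  cross-multiplied : ∀ x → (+ 1 ℤ.* x) ℤ.* + 1 ≡ + 1 ℤ.* (x ℤ.* + 1)
  cross-multiplied = ℤ-Solver.solve-∀

open CubeSum ℚ.+-*-commutativeRing
open ≡.≡-Reasoning

ℚ-ring : AlmostCommutativeRing _ _
ℚ-ring = fromCommutativeRing ℚ.+-*-commutativeRing (λ q → dec⇒maybe (0ℚ ℚ.≟ q))

two : ℚ
two = + 2 / 1

-- p = (1 - ρ p) / 2: bit-flip mutation is the noise operator T_ρ of Boolean Fourier analysis.
ρ : ℚ → ℚ
ρ p = 1ℚ - two * p

sign : Bool → ℚ
sign false = 1ℚ
sign true  = - 1ℚ

χ : ∀ {n} → Bits n → Bits n → ℚ
χ []      []      = 1ℚ
χ (a ∷ u) (b ∷ w) = sign (a ∧ b) * χ u w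

χ-comm : ∀ {n} (u w : Bits n) → χ u w ≡ χ w u
χ-comm []      []      = refl
χ-comm (a ∷ u) (b ∷ w) = cong₂ (λ c x → sign c * x) (∧-comm a b) (χ-comm u w)

sign-xor : ∀ a b → sign a * sign b ≡ sign (a xor b)
sign-xor false false = refl
sign-xor false true  = refl
sign-xor true  false = refl
sign-xor true  true  = refl

one-bit-spectral : ∀ p c → 1ℚ + ρ p * sign c ≡ two * (if c then p else 1ℚ - p)
one-bit-spectral p false = kept p
  where
  kept : ∀ p → 1ℚ + (1ℚ - two * p) * 1ℚ ≡ two * (1ℚ - p)
  kept = solve-∀ ℚ-ring
one-bit-spectral p true  = flipped p
  where
  flipped : ∀ p → 1ℚ + (1ℚ - two * p) * - 1ℚ ≡ two * p
  flipped = solve-∀ ℚ-ring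

mutProb-spectral : ∀ {n} p (x y : Bits n) →
  fromℤ (+ (2 ℕ.^ n)) * mutProb p x y ≡ ∑[ z ∈ allBits n ] ((ρ p ^ℚ ones z) * (χ z x * χ z y))
mutProb-spectral p []      []      = refl
mutProb-spectral {suc n} p (a ∷ x) (b ∷ y) = begin
  fromℤ (+ (2 ℕ.^ suc n)) * (flip * mutProb p x y)
    ≡⟨ cong (_* (flip * mutProb p x y)) (trans (cong fromℤ (ℤ.pos-* 2 (2 ℕ.^ n)))
                                               (fromℤ-homo-* (+ 2) (+ (2 ℕ.^ n)))) ⟩
  (two * fromℤ (+ (2 ℕ.^ n))) * (flip * mutProb p x y)
    ≡⟨ regroup two (fromℤ (+ (2 ℕ.^ n))) flip (mutProb p x y) ⟩
  (two * flip) * (fromℤ (+ (2 ℕ.^ n)) * mutProb p x y)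
    ≡⟨ cong₂ _*_ (sym (one-bit-spectral p (a xor b))) (mutProb-spectral p x y) ⟩
  (1ℚ + c) * S
    ≡⟨ ℚ.*-distribʳ-+ S 1ℚ c ⟩
  1ℚ * S + c * S
    ≡⟨ cong₂ _+_ (trans (ℚ.*-identityˡ S) (∑-cong (allBits n) (λ z → sym (unsigned z))))
                 (trans (sym (∑-*ˡ (allBits n) c G)) (∑-cong (allBits n) (λ z → sym (signed z)))) ⟩
  ∑[ z ∈ allBits n ] F (false ∷ z) + ∑[ z ∈ allBits n ] F (true ∷ z)
    ≡⟨ ∑-allBits-suc n F ⟨
  ∑ (allBits (suc n)) F ∎
  where
  flip c : ℚ
  flip = if a xor b then p else 1ℚ - p
  c = ρ p * sign (a xor b)
  F : Bits (suc n) → ℚ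
  F z = (ρ p ^ℚ ones z) * (χ z (a ∷ x) * χ z (b ∷ y))
  G : Bits n → ℚ
  G z = (ρ p ^ℚ ones z) * (χ z x * χ z y)
  S : ℚ
  S = ∑ (allBits n) G
  regroup : ∀ t u f m → (t * u) * (f * m) ≡ (t * f) * (u * m)
  regroup = solve-∀ ℚ-ring
  unsigned : ∀ z → F (false ∷ z) ≡ G z
  unsigned z = cong ((ρ p ^ℚ ones z) *_) (cong₂ _*_ (ℚ.*-identityˡ (χ z x)) (ℚ.*-identityˡ (χ z y)))
  rearrange : ∀ r t sa sb u v → (r * t) * ((sa * u) * (sb * v)) ≡ r * (sa * sb) * (t * (u * v))
  rearrange = solve-∀ ℚ-ring
  signed : ∀ z → F (true ∷ z) ≡ c * G z
  signed z = trans (rearrange (ρ p) (ρ p ^ℚ ones z) (sign a) (sign b) (χ z x) (χ z y))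
                   (cong (λ s → ρ p * s * G z) (sign-xor a b))

levelSum-χ-cons : ∀ {n} r a (w : Bits n) →
  levelSum (suc n) (suc r) (λ u → χ u (a ∷ w)) ≡
  levelSum n (suc r) (λ u → χ u w) + sign a * levelSum n r (λ u → χ u w)
levelSum-χ-cons {n} r a w = trans (levelSum-suc n r _)
  (cong₂ _+_ (levelSum-cong n (suc r) (λ u → ℚ.*-identityˡ (χ u w)))
             (sym (*-levelSum n r (sign a) (λ u → χ u w))))

levelSum-χ-kraw : ∀ {n} (w : Bits n) r → levelSum n r (λ u → χ u w) ≡ fromℤ (kraw (n ∸ ones w) r (ones w))
levelSum-χ-kraw []      zero    = refl
levelSum-χ-kraw []      (suc r) = refl
levelSum-χ-kraw {suc n} (a ∷ w) zero = begin
  levelSum (suc n) 0 (λ u → χ u (a ∷ w))               ≡⟨ levelSum-zero n _ ⟩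
  levelSum n 0 (λ u → 1ℚ * χ u w)                       ≡⟨ levelSum-cong n 0 (λ u → ℚ.*-identityˡ (χ u w)) ⟩
  levelSum n 0 (λ u → χ u w)                            ≡⟨ levelSum-χ-kraw w 0 ⟩
  fromℤ (kraw (n ∸ ones w) 0 (ones w))                  ≡⟨ cong fromℤ (kraw-row-zero (n ∸ ones w) (ones w)) ⟩
  fromℤ (+ 1)                                           ≡⟨ cong fromℤ (kraw-row-zero (suc n ∸ ones (a ∷ w))
                                                                                  (ones (a ∷ w))) ⟨
  fromℤ (kraw (suc n ∸ ones (a ∷ w)) 0 (ones (a ∷ w)))  ∎
levelSum-χ-kraw {suc n} (false ∷ w) (suc r) = begin
  levelSum (suc n) (suc r) (λ u → χ u (false ∷ w))     ≡⟨ levelSum-χ-cons r false w ⟩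
  L (suc r) + 1ℚ * L r                                 ≡⟨ cong₂ (λ s t → s + 1ℚ * t) (levelSum-χ-kraw w (suc r))
                                                                                     (levelSum-χ-kraw w r) ⟩
  fromℤ (kraw d (suc r) j) + 1ℚ * fromℤ (kraw d r j)   ≡⟨ cong (_+_ (fromℤ (kraw d (suc r) j)))
                                                               (ℚ.*-identityˡ (fromℤ (kraw d r j))) ⟩
  fromℤ (kraw d (suc r) j) + fromℤ (kraw d r j)        ≡⟨ fromℤ-homo-+ (kraw d (suc r) j) (kraw d r j) ⟨
  fromℤ (kraw d (suc r) j ℤ.+ kraw d r j)              ≡⟨ cong fromℤ (kraw-pascal⁺ d r j) ⟨
  fromℤ (kraw (suc d) (suc r) j)                       ≡⟨ cong (λ e → fromℤ (kraw e (suc r) j))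
                                                               (ℕ.+-∸-assoc 1 (ones≤length w)) ⟨
  fromℤ (kraw (suc n ∸ j) (suc r) j)                   ∎
  where
  d j : ℕ
  d = n ∸ ones w
  j = ones w
  L : ℕ → ℚ
  L k = levelSum n k (λ u → χ u w)
levelSum-χ-kraw {suc n} (true ∷ w) (suc r) = begin
  levelSum (suc n) (suc r) (λ u → χ u (true ∷ w))      ≡⟨ levelSum-χ-cons r true w ⟩
  L (suc r) + - 1ℚ * L r                               ≡⟨ cong₂ (λ s t → s + - 1ℚ * t) (levelSum-χ-kraw w (suc r))
                                                                                       (levelSum-χ-kraw w r) ⟩
  fromℤ (kraw d (suc r) j) + - 1ℚ * fromℤ (kraw d r j) ≡⟨ cong (_+_ (fromℤ (kraw d (suc r) j)))
                                                               (-1*x≈-x (fromℤ (kraw d r j))) ⟩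
  fromℤ (kraw d (suc r) j) + - fromℤ (kraw d r j)      ≡⟨ cong (_+_ (fromℤ (kraw d (suc r) j)))
                                                               (fromℤ-homo‿- (kraw d r j)) ⟨
  fromℤ (kraw d (suc r) j) + fromℤ (ℤ.- kraw d r j)    ≡⟨ fromℤ-homo-+ (kraw d (suc r) j) (ℤ.- kraw d r j) ⟨
  fromℤ (kraw d (suc r) j ℤ.- kraw d r j)              ≡⟨ cong fromℤ (kraw-pascal⁻ d r j) ⟨
  fromℤ (kraw d (suc r) (suc j))                       ∎
  where
  d j : ℕ
  d = n ∸ ones w
  j = ones w
  L : ℕ → ℚ
  L k = levelSum n k (λ u → χ u w)

levelSum-χ : ∀ {n} r (w : Bits n) → levelSum n r (λ u → χ u w) ≡ fromℤ (K n r (ones w))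
levelSum-χ r w = trans (levelSum-χ-kraw w r) (cong fromℤ (sym (K≡kraw r (ones≤length w))))

ones-complement : ∀ {n} (x : Bits n) → ones (complement x) ℕ.+ ones x ≡ n
ones-complement []          = refl
ones-complement (true ∷ x)  = trans (ℕ.+-suc _ (ones x)) (cong suc (ones-complement x))
ones-complement (false ∷ x) = cong suc (ones-complement x)

f≡ξ⇔ : ∀ {n} (y : Bits n) j → f y ≡ ξ n j ⇔ j ℕ.+ ones y ≡ n
f≡ξ⇔ {n} y j = mk⇔ to from
  where
  a : ℕ
  a = ones y
  split : ∀ n j a → + 2 ℤ.* (j ℤ.+ a) ≡ (+ 2 ℤ.* j ℤ.- n) ℤ.+ (n ℤ.+ + 2 ℤ.* a)
  split = ℤ-Solver.solve-∀
  join : ∀ n a → (n ℤ.- + 2 ℤ.* a) ℤ.+ (n ℤ.+ + 2 ℤ.* a) ≡ + 2 ℤ.* n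
  join = ℤ-Solver.solve-∀
  balance : ∀ j a → (j ℤ.+ a) ℤ.- + 2 ℤ.* a ≡ + 2 ℤ.* j ℤ.- (j ℤ.+ a)
  balance = ℤ-Solver.solve-∀
  to : f y ≡ ξ n j → j ℕ.+ a ≡ n
  to fy≡ξ = ℤ.+-injective (ℤ.*-cancelˡ-≡ (+ 2) (+ (j ℕ.+ a)) (+ n) (begin
    + 2 ℤ.* + (j ℕ.+ a)                ≡⟨ cong (+ 2 ℤ.*_) (ℤ.pos-+ j a) ⟩
    + 2 ℤ.* (+ j ℤ.+ + a)              ≡⟨ split (+ n) (+ j) (+ a) ⟩
    ξ n j ℤ.+ (+ n ℤ.+ + 2 ℤ.* + a)    ≡⟨ cong (ℤ._+ (+ n ℤ.+ + 2 ℤ.* + a)) fy≡ξ ⟨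
    f y ℤ.+ (+ n ℤ.+ + 2 ℤ.* + a)      ≡⟨ join (+ n) (+ a) ⟩
    + 2 ℤ.* + n                        ∎))
  from : j ℕ.+ a ≡ n → f y ≡ ξ n j
  from j+a≡n = ≡.subst (λ m → + m ℤ.- + 2 ℤ.* + a ≡ + 2 ℤ.* + j ℤ.- + m) j+a≡n (begin
    + (j ℕ.+ a) ℤ.- + 2 ℤ.* + a        ≡⟨ cong (λ b → b ℤ.- + 2 ℤ.* + a) (ℤ.pos-+ j a) ⟩
    (+ j ℤ.+ + a) ℤ.- + 2 ℤ.* + a      ≡⟨ balance (+ j) (+ a) ⟩
    + 2 ℤ.* + j ℤ.- (+ j ℤ.+ + a)      ≡⟨ cong (λ b → + 2 ℤ.* + j ℤ.- b) (ℤ.pos-+ j a) ⟨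
    + 2 ℤ.* + j ℤ.- + (j ℕ.+ a)        ∎)

f≡ξ⇔ones-complement≡ : ∀ {n} (y : Bits n) j → f y ≡ ξ n j ⇔ ones (complement y) ≡ j
f≡ξ⇔ones-complement≡ {n} y j = ⇔-trans (f≡ξ⇔ y j) (mk⇔ to from)
  where
  to : j ℕ.+ ones y ≡ n → ones (complement y) ≡ j
  to j+a≡n = ℕ.+-cancelʳ-≡ (ones y) (ones (complement y)) j (trans (ones-complement y) (sym j+a≡n))
  from : ones (complement y) ≡ j → j ℕ.+ ones y ≡ n
  from c≡j = trans (cong (ℕ._+ ones y) (sym c≡j)) (ones-complement y)

mutProb-complement : ∀ {n} p (x y : Bits n) → mutProb p (complement x) (complement y) ≡ mutProb p x y
mutProb-complement p []      []      = refl
mutProb-complement p (a ∷ x) (b ∷ y) =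
  cong₂ (λ c m → (if c then p else 1ℚ - p) * m) (not-xor-not a b) (mutProb-complement p x y)
  where
  not-xor-not : ∀ a b → not a xor not b ≡ a xor b
  not-xor-not false false = refl
  not-xor-not false true  = refl
  not-xor-not true  false = refl
  not-xor-not true  true  = refl

PrMut≡levelSum : ∀ {n} p (x : Bits n) j → PrMut p x (ξ n j) ≡ levelSum n j (mutProb p (complement x))
PrMut≡levelSum {n} p x j = trans
  (∑-cong (allBits n) (λ y → cong₂ (λ b q → if b then q else 0ℚ) (test y) (sym (mutProb-complement p x y))))
  (∑-allBits-complement n (λ y → if ones y ≡ᵇ j then mutProb p (complement x) y else 0ℚ))
  where
  test : ∀ y → ⌊ f y ℤ.≟ ξ n j ⌋ ≡ (ones (complement y) ≡ᵇ j)
  test y = trans (isYes≗does (f y ℤ.≟ ξ n j))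
                 (does-⇔ (f≡ξ⇔ones-complement≡ y j) (f y ℤ.≟ ξ n j) (ones (complement y) ℕ.≟ j))

levelSum-mutProb : ∀ {n} p j (w : Bits n) →
  fromℤ (+ (2 ℕ.^ n)) * levelSum n j (mutProb p w) ≡
  ∑[ l ∈ upTo (suc n) ] ((fromℤ (K n j l) * ρ p ^ℚ l) * fromℤ (K n l (ones w)))
levelSum-mutProb {n} p j w = begin
  fromℤ (+ (2 ℕ.^ n)) * levelSum n j (mutProb p w)
    ≡⟨ *-levelSum n j (fromℤ (+ (2 ℕ.^ n))) (mutProb p w) ⟩
  levelSum n j (λ y → fromℤ (+ (2 ℕ.^ n)) * mutProb p w y)
    ≡⟨ levelSum-cong n j (λ y → trans (mutProb-spectral p w y) (∑-cong (allBits n) (λ z → split z y))) ⟩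
  levelSum n j (λ y → ∑[ z ∈ allBits n ] (c z * χ y z))
    ≡⟨ levelSum-∑ n j (allBits n) (λ z y → c z * χ y z) ⟩
  ∑[ z ∈ allBits n ] levelSum n j (λ y → c z * χ y z)
    ≡⟨ ∑-cong (allBits n) (λ z → trans (sym (*-levelSum n j (c z) (λ y → χ y z))) (cong (c z *_) (levelSum-χ j z))) ⟩
  ∑[ z ∈ allBits n ] (c z * fromℤ (K n j (ones z)))
    ≡⟨ ∑-by-levels n (λ z → c z * fromℤ (K n j (ones z))) ⟩
  ∑[ l ∈ upTo (suc n) ] levelSum n l (λ z → c z * fromℤ (K n j (ones z)))
    ≡⟨ ∑-cong (upTo (suc n)) (λ l → trans (levelSum-cong n l regroup) (levelSum-ones n l F (λ z → χ z w))) ⟩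
  ∑[ l ∈ upTo (suc n) ] (F l * levelSum n l (λ z → χ z w))
    ≡⟨ ∑-cong (upTo (suc n)) (λ l → cong (F l *_) (levelSum-χ l w)) ⟩
  ∑[ l ∈ upTo (suc n) ] (F l * fromℤ (K n l (ones w))) ∎
  where
  c : Bits n → ℚ
  c z = (ρ p ^ℚ ones z) * χ z w
  F : ℕ → ℚ
  F l = fromℤ (K n j l) * ρ p ^ℚ l
  split : ∀ z y → (ρ p ^ℚ ones z) * (χ z w * χ z y) ≡ c z * χ y z
  split z y = trans (sym (ℚ.*-assoc (ρ p ^ℚ ones z) (χ z w) (χ z y))) (cong (c z *_) (χ-comm z y))
  swap : ∀ t x k → (t * x) * k ≡ (k * t) * x
  swap = solve-∀ ℚ-ring
  regroup : ∀ z → c z * fromℤ (K n j (ones z)) ≡ F (ones z) * χ z w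
  regroup z = swap (ρ p ^ℚ ones z) (χ z w) (fromℤ (K n j (ones z)))

-- Both sides are polynomials in p.
theorem5 : (n : ℕ) (p : ℚ) → 0ℚ ≤ℚ p → p ≤ℚ 1ℚ →
           (i j : ℕ) → i ≤ n → j ≤ n →
           (x : Bits n) → f x ≡ ξ n i →
           PrMut p x (ξ n j) ≡ ϖ n p i j
theorem5 n p _ _ i j _ _ x fx≡ξ = begin
  PrMut p x (ξ n j)                ≡⟨ PrMut≡levelSum p x j ⟩
  L                                ≡⟨ ℚ.*-identityˡ L ⟨
  1ℚ * L                           ≡⟨ cong (_* L) (1/-*-fromℤ (2 ℕ.^ n) {{ℕ.m^n≢0 2 n}}) ⟨
  (2⁻ⁿ * fromℤ (+ (2 ℕ.^ n))) * L  ≡⟨ ℚ.*-assoc 2⁻ⁿ (fromℤ (+ (2 ℕ.^ n))) L ⟩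
  2⁻ⁿ * (fromℤ (+ (2 ℕ.^ n)) * L)  ≡⟨ cong (2⁻ⁿ *_) (levelSum-mutProb p j (complement x)) ⟩
  2⁻ⁿ * ∑[ l ∈ upTo (suc n) ] ((fromℤ (K n j l) * ρ p ^ℚ l) * fromℤ (K n l (ones (complement x))))
    ≡⟨ cong (λ m → 2⁻ⁿ * ∑[ l ∈ upTo (suc n) ] ((fromℤ (K n j l) * ρ p ^ℚ l) * fromℤ (K n l m)))
            (Equivalence.to (f≡ξ⇔ones-complement≡ x i) fx≡ξ) ⟩
  ϖ n p i j                        ∎
  where
  L : ℚ
  L = levelSum n j (mutProb p (complement x))
  2⁻ⁿ : ℚ
  2⁻ⁿ = (+ 1 / 2 ℕ.^ n) {{ℕ.m^n≢0 2 n}}
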